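{- Let $q$ be a prime power, $n\ge1$, $H(X)\in\mathbb{F}_{q^n}[X]$ and $\gamma,\beta\in\mathbb{F}_{q^n}$. Then $$F(X)=X+\gamma\,Tr\big(H(X^q-\gamma^{q-1}X)+\beta X\big)$$ is a permutation polynomial of $\mathbb{F}_{q^n}$ if and only if $Tr(\gamma\beta)\neq-1$.
   Context: $Tr$ denotes the trace map from $\mathbb{F}_{q^n}$ to $\mathbb{F}_q$, $Tr(y)=y+y^q+\dots+y^{q^{n-1}}$. -}

module Defs where

open import Level using (Level; _⊔_; suc)
open import Data.Nat as ℕ using (ℕ; zero; suc; _≤_)
open import Data.Nat.Primality using (Prime)
open import Data.Fin using (Fin)
open import Data.List using (List; []; _∷_)
open import Data.Product using (Σ; _×_; ∃; _,_)
open import Relation.Binary.PropositionalEquality using (_≡_)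
open import Relation.Nullary using (¬_)
open import Algebra.Bundles using (CommutativeRing)

IsPrimePower : ℕ → Set
IsPrimePower q = Σ ℕ λ p → Σ ℕ λ k → Prime p × (1 ≤ k) × (q ≡ p ℕ.^ k)

record Field (c ℓ : Level) : Set (Level.suc (c ⊔ ℓ)) where
  field
    commutativeRing : CommutativeRing c ℓ
  open CommutativeRing commutativeRing public
  field
    1≉0     : ¬ (1# ≈ 0#)
    inverse : ∀ x → ¬ (x ≈ 0#) → Σ Carrier λ y → (x * y) ≈ 1#

module _ {c ℓ : Level} (K : Field c ℓ) where
  open Field K

  HasCardinality : ℕ → Set (c ⊔ ℓ)
  HasCardinality m =
    Σ (Fin m → Carrier) λ e →
      (∀ i j → e i ≈ e j → i ≡ j) × (∀ x → Σ (Fin m) λ i → e i ≈ x)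

  pow : Carrier → ℕ → Carrier
  pow x zero    = 1#
  pow x (suc k) = x * pow x k

  Tr : ℕ → ℕ → Carrier → Carrier
  Tr q zero    y = 0#
  Tr q (suc i) y = Tr q i y + pow y (q ℕ.^ i)

  -- polynomials as coefficient lists a₀ ∷ a₁ ∷ ... (constant term first); Horner evaluation
  eval : List Carrier → Carrier → Carrier
  eval []       x = 0#
  eval (a ∷ as) x = a + x * eval as x

  IsPermutation : (Carrier → Carrier) → Set (c ⊔ ℓ)
  IsPermutation f =
    (∀ x y → f x ≈ f y → x ≈ y) × (∀ z → Σ Carrier λ x → f x ≈ z)

-- Write L(x) = x^q - γ^(q-1) x, G(x) = Tr(H(L(x)) + β x), F(x) = x + γ G(x) and
-- t = Tr(γβ).  For a in the fixed field 𝔽 of x ↦ x^q, L is invariant under x ↦ x + γ a and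
-- Tr is 𝔽-linear, so F(x + γ a) = F(x) + γ a (1 + t).  If t = -1 then F(x + γ) = F(x), which
-- for injective F forces γ = 0 and hence t = 0, a contradiction.  If t ≠ -1 and F(x) = F(y),
-- then x = y + γ a with a = G(y) - G(x) ∈ 𝔽 (traces are fixed by x ↦ x^q), so γ a (1 + t) = 0
-- and x = y; on the finite set K injectivity gives bijectivity.

module Submission where

open import Defs
open import Level using (Level)
open import Data.Nat as ℕ using (ℕ; _≤_; _∸_)
open import Data.List using (List)
open import Relation.Nullary using (¬_)
open import Function.Bundles using (_⇔_)

open import Level using (_⊔_)
open import Data.Nat using (zero; suc; _<_; _!; z≤n; s≤s; NonZero)
import Data.Nat.Properties as ℕP
open import Data.Nat.Properties using (_!*_!≢0)
open import Data.Nat.Divisibility using (_∣_; divides; ∣⇒≤; ∣1⇒≡1; m∣m*n)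
open import Data.Nat.DivMod using (m/n*n≡m)
open import Data.Nat.Primality using (Prime; euclidsLemma; prime⇒nonTrivial; prime⇒nonZero)
open import Data.Nat.Combinatorics using (_C_; nCn≡1; k![n∸k]!∣n!)
open import Data.Nat.Combinatorics.Specification using (nCk≡n!/k![n-k]!)
open import Data.Sum using (inj₁; inj₂)
open import Data.Product using (Σ; _,_; proj₁; proj₂)
open import Data.Fin as Fin using (Fin; punchIn; punchOut)
import Data.Fin.Properties as FinP
open import Data.Fin.Permutation using (Permutation; permutation)
open import Data.List using ([]; _∷_)
open import Algebra.Bundles using (CommutativeMonoid)
open import Function.Bundles using (mk⇔)
open import Relation.Nullary using (Dec; yes; no; contradiction)
open import Relation.Binary.PropositionalEquality as ≡ using (_≡_)

∣-own-factorial : ∀ n → .{{NonZero n}} → n ∣ n !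
∣-own-factorial (suc r) = m∣m*n (r !)

module _ {p : ℕ} (p-prime : Prime p) where

  -- No factorial j! with j < p is divisible by p: by Euclid's lemma p would divide some factor i ≤ j.
  prime∤factorial : ∀ j → j < p → ¬ (p ∣ j !)
  prime∤factorial zero    _   p∣1 =
    ℕP.<-irrefl (≡.sym (∣1⇒≡1 p∣1)) (ℕ.nonTrivial⇒n>1 p {{prime⇒nonTrivial p-prime}})
  prime∤factorial (suc j) j<p p∣j! with euclidsLemma (suc j) (j !) p-prime p∣j!
  ... | inj₁ p∣1+j = ℕP.<⇒≱ j<p (∣⇒≤ p∣1+j)
  ... | inj₂ p∣j!′ = prime∤factorial j (ℕP.<-trans (ℕP.n<1+n j) j<p) p∣j!′

  -- Writing p! = (p C k) · (k! (p-k)!) exhibits a multiple of p.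
  p∣binomial*factorials : ∀ k → k ≤ p → p ∣ (p C k) ℕ.* (k ! ℕ.* (p ∸ k) !)
  p∣binomial*factorials k k≤p = ≡.subst (p ∣_) (≡.sym factorisation)
    (∣-own-factorial p {{prime⇒nonZero p-prime}})
    where
    instance
      factorials≢0 : NonZero (k ! ℕ.* (p ∸ k) !)
      factorials≢0 = k !* (p ∸ k) !≢0
    factorisation : (p C k) ℕ.* (k ! ℕ.* (p ∸ k) !) ≡ p !
    factorisation = ≡.trans (≡.cong (ℕ._* (k ! ℕ.* (p ∸ k) !)) (nCk≡n!/k![n-k]! k≤p))
                            (m/n*n≡m (k![n∸k]!∣n! k≤p))

  -- p divides the inner binomial coefficients p C k (0 < k < p): by Euclid's lemma it divides
  -- p C k or one of k!, (p-k)!, and the latter two are excluded by prime∤factorial.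
  prime∣binomial : ∀ k → 0 < k → k < p → p ∣ p C k
  prime∣binomial k 0<k k<p
    with euclidsLemma (p C k) (k ! ℕ.* (p ∸ k) !) p-prime (p∣binomial*factorials k (ℕP.<⇒≤ k<p))
  ... | inj₁ p∣C = p∣C
  ... | inj₂ p∣k![p∸k]! with euclidsLemma (k !) ((p ∸ k) !) p-prime p∣k![p∸k]!
  ...   | inj₁ p∣k!     = contradiction p∣k! (prime∤factorial k k<p)
  ...   | inj₂ p∣[p∸k]! = contradiction p∣[p∸k]!
                            (prime∤factorial (p ∸ k) (ℕP.∸-monoʳ-< {p} {k} {0} 0<k (ℕP.<⇒≤ k<p)))

-- Pigeonhole principle: an injective endomap of the finite set Fin m is surjective.
-- If y were missed, f would inject Fin m into Fin m minus y, which has m - 1 elements.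
finInjective⇒surjective : ∀ {m} (f : Fin m → Fin m) → (∀ i j → f i ≡ f j → i ≡ j) →
                          ∀ y → Σ (Fin m) λ i → f i ≡ y
finInjective⇒surjective {suc m} f f-inj y with FinP.any? (λ i → f i Fin.≟ y)
... | yes hit = hit
... | no miss = contradiction (FinP.injective⇒≤ g-inj) ℕP.1+n≰n
  where
  g : Fin (suc m) → Fin m
  g i = punchOut {i = y} {j = f i} (λ y≡fi → miss (i , ≡.sym y≡fi))
  g-inj : ∀ {i j} → g i ≡ g j → i ≡ j
  g-inj {i} {j} gi≡gj = f-inj i j
    (FinP.punchOut-injective (λ e → miss (i , ≡.sym e)) (λ e → miss (j , ≡.sym e)) gi≡gj)

finInjective⇒permutation : ∀ {m} (f : Fin m → Fin m) → (∀ i j → f i ≡ f j → i ≡ j) → Permutation m m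
finInjective⇒permutation f f-inj = permutation f (λ y → proj₁ (onto y)) (λ y → proj₂ (onto y))
  (λ x → f-inj _ _ (proj₂ (onto (f x))))
  where
  onto : ∀ y → Σ (Fin _) λ i → f i ≡ y
  onto = finInjective⇒surjective f f-inj

module FieldTheory {c ℓ : Level} (K : Field c ℓ) where
  open Field K hiding (zero)
  open import Algebra.Properties.Ring ring
    using (+-cancelˡ; +-cancelʳ; +-identityʳ-unique; +-inverseʳ-unique; -‿+-comm; //-rightDividesˡ; //-rightDividesʳ; x[y-z]≈xy-xz; [y-z]x≈yx-zx; x∙y⁻¹≈ε⇒x≈y; x≈y⇒x∙y⁻¹≈ε)
  open import Algebra.Properties.Semiring.Mult semiring using (_×_; ×-congʳ; ×-assoc-*; ×1-homo-*)
  open import Algebra.Properties.Semiring.Exp semiring using (_^_; ^-congˡ; ^-assocʳ)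
  open import Algebra.Properties.CommutativeSemiring.Exp commutativeSemiring using (^-distrib-*)
  open import Algebra.Properties.CommutativeSemigroup +-commutativeSemigroup using (interchange)
  open import Relation.Binary.Reasoning.Setoid setoid

  nonzero-cancelˡ : ∀ {x y} → ¬ (x ≈ 0#) → x * y ≈ 0# → y ≈ 0#
  nonzero-cancelˡ {x} {y} x≉0 xy≈0 with inverse x x≉0
  ... | x⁻¹ , xx⁻¹≈1 = begin
    y              ≈⟨ *-identityˡ y ⟨
    1# * y         ≈⟨ *-congʳ (trans (sym xx⁻¹≈1) (*-comm x x⁻¹)) ⟩
    (x⁻¹ * x) * y  ≈⟨ *-assoc x⁻¹ x y ⟩
    x⁻¹ * (x * y)  ≈⟨ *-congˡ xy≈0 ⟩
    x⁻¹ * 0#       ≈⟨ zeroʳ x⁻¹ ⟩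
    0#             ∎

  nonzero-cancelʳ : ∀ {x y} → ¬ (y ≈ 0#) → x * y ≈ 0# → x ≈ 0#
  nonzero-cancelʳ y≉0 xy≈0 = nonzero-cancelˡ y≉0 (trans (*-comm _ _) xy≈0)

  nonzero-* : ∀ {x y} → ¬ (x ≈ 0#) → ¬ (y ≈ 0#) → ¬ (x * y ≈ 0#)
  nonzero-* x≉0 y≉0 xy≈0 = y≉0 (nonzero-cancelˡ x≉0 xy≈0)

  -- The power function of the statement agrees with the library's semiring exponentiation,
  -- so the library's laws of exponents transfer to it.
  pow≈^ : ∀ x k → pow K x k ≈ x ^ k
  pow≈^ x zero    = refl
  pow≈^ x (suc k) = *-congˡ (pow≈^ x k)

  pow-cong : ∀ k {x y} → x ≈ y → pow K x k ≈ pow K y k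
  pow-cong k {x} {y} x≈y = trans (pow≈^ x k) (trans (^-congˡ k x≈y) (sym (pow≈^ y k)))

  pow-pow : ∀ x a b → pow K (pow K x a) b ≈ pow K x (a ℕ.* b)
  pow-pow x a b = begin
    pow K (pow K x a) b   ≈⟨ pow≈^ _ b ⟩
    pow K x a ^ b         ≈⟨ ^-congˡ b (pow≈^ x a) ⟩
    (x ^ a) ^ b           ≈⟨ ^-assocʳ x a b ⟩
    x ^ (a ℕ.* b)         ≈⟨ pow≈^ x (a ℕ.* b) ⟨
    pow K x (a ℕ.* b)     ∎

  pow-distrib-* : ∀ x y k → pow K (x * y) k ≈ pow K x k * pow K y k
  pow-distrib-* x y k = begin
    pow K (x * y) k          ≈⟨ pow≈^ (x * y) k ⟩
    (x * y) ^ k              ≈⟨ ^-distrib-* x y k ⟩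
    x ^ k * y ^ k            ≈⟨ *-cong (pow≈^ x k) (pow≈^ y k) ⟨
    pow K x k * pow K y k    ∎

  pow-1# : ∀ k → pow K 1# k ≈ 1#
  pow-1# zero    = refl
  pow-1# (suc k) = trans (*-identityˡ _) (pow-1# k)

  pow-nonzero : ∀ {x} k → ¬ (x ≈ 0#) → ¬ (pow K x k ≈ 0#)
  pow-nonzero zero    x≉0 = 1≉0
  pow-nonzero (suc k) x≉0 = nonzero-* x≉0 (pow-nonzero k x≉0)

  pow-pred : ∀ x {k} → 1 ≤ k → pow K x k ≈ x * pow K x (k ∸ 1)
  pow-pred x {suc k} _ = refl

  eval-cong : ∀ H {x y} → x ≈ y → eval K H x ≈ eval K H y
  eval-cong []      x≈y = refl
  eval-cong (a ∷ H) x≈y = +-congˡ (*-cong x≈y (eval-cong H x≈y))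

  Tr-cong : ∀ q i {x y} → x ≈ y → Tr K q i x ≈ Tr K q i y
  Tr-cong q zero    x≈y = refl
  Tr-cong q (suc i) x≈y = +-cong (Tr-cong q i x≈y) (pow-cong (q ℕ.^ i) x≈y)

  ×1-homo-^ : ∀ r e → (r ℕ.^ e) × 1# ≈ pow K (r × 1#) e
  ×1-homo-^ r zero    = +-identityʳ 1#
  ×1-homo-^ r (suc e) = trans (×1-homo-* r (r ℕ.^ e)) (*-congˡ (×1-homo-^ r e))

  Additive : ℕ → Set (c ⊔ ℓ)
  Additive N = ∀ x y → pow K (x + y) N ≈ pow K x N + pow K y N

  multiple-of-characteristic : ∀ {p C} b → p × 1# ≈ 0# → p ∣ C → C × b ≈ 0#
  multiple-of-characteristic {p} b p·1≈0 (divides d ≡.refl) = begin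
    (d ℕ.* p) × b              ≈⟨ ×-congʳ (d ℕ.* p) (*-identityˡ b) ⟨
    (d ℕ.* p) × (1# * b)       ≈⟨ ×-assoc-* (d ℕ.* p) 1# b ⟨
    ((d ℕ.* p) × 1#) * b       ≈⟨ *-congʳ (×1-homo-* d p) ⟩
    ((d × 1#) * (p × 1#)) * b  ≈⟨ *-congʳ (*-congˡ p·1≈0) ⟩
    ((d × 1#) * 0#) * b        ≈⟨ *-congʳ (zeroʳ _) ⟩
    0# * b                     ≈⟨ zeroˡ b ⟩
    0#                         ∎

  -- Frobenius: in characteristic p (p prime) we have (x + y)^p = x^p + y^p, because in the
  -- binomial expansion every inner coefficient p C j (0 < j < p) is a multiple of p.
  module Frobenius {r : ℕ} (p-prime : Prime (suc r)) (p·1≈0 : suc r × 1# ≈ 0#) (x y : Carrier) where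
    import Algebra.Properties.CommutativeSemiring.Binomial commutativeSemiring as Binomial
    open import Algebra.Properties.CommutativeMonoid.Sum +-commutativeMonoid
      using (sum; sum-init-last; sum-cong-≋; sum-replicate-zero)

    p : ℕ
    p = suc r

    term : ℕ → Carrier
    term j = (p C j) × (x ^ j * y ^ (p ∸ j))

    term-cong : ∀ {i j} → i ≡ j → term i ≈ term j
    term-cong ≡.refl = refl

    first-term : term 0 ≈ y ^ p
    first-term = trans (+-identityʳ _) (*-identityˡ _)

    last-term : term p ≈ x ^ p
    last-term rewrite nCn≡1 p | ℕP.n∸n≡0 p = trans (+-identityʳ _) (*-identityʳ _)

    inner-term : ∀ (i : Fin r) → term (suc (Fin.toℕ (Fin.inject₁ i))) ≈ 0#
    inner-term i = multiple-of-characteristic _ p·1≈0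
      (prime∣binomial p-prime (suc j) (s≤s z≤n) (s≤s j<r))
      where
      j : ℕ
      j = Fin.toℕ (Fin.inject₁ i)
      j<r : j < r
      j<r = ≡.subst (_< r) (≡.sym (FinP.toℕ-inject₁ i)) (FinP.toℕ<n i)

    frobenius^ : (x + y) ^ p ≈ x ^ p + y ^ p
    frobenius^ = begin
      (x + y) ^ p                                ≈⟨ Binomial.theorem p x y ⟩
      term 0 + sum (λ (k : Fin p) → term (suc (Fin.toℕ k)))
                                                 ≈⟨ +-congˡ (sum-init-last {r} (λ k → term (suc (Fin.toℕ k)))) ⟩
      term 0 + (sum {r} (λ i → term (suc (Fin.toℕ (Fin.inject₁ i)))) + term (suc (Fin.toℕ (Fin.fromℕ r))))
                                                 ≈⟨ +-cong first-term (+-cong (sum-cong-≋ {r} {y = λ _ → 0#} inner-term) last) ⟩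
      y ^ p + (sum {r} (λ _ → 0#) + x ^ p)       ≈⟨ +-congˡ (+-congʳ (sum-replicate-zero r)) ⟩
      y ^ p + (0# + x ^ p)                       ≈⟨ +-congˡ (+-identityˡ _) ⟩
      y ^ p + x ^ p                              ≈⟨ +-comm _ _ ⟩
      x ^ p + y ^ p                              ∎
      where
      last : term (suc (Fin.toℕ (Fin.fromℕ r))) ≈ x ^ p
      last = trans (term-cong (≡.cong suc (FinP.toℕ-fromℕ r))) last-term

  frobenius : ∀ {p} → Prime p → p × 1# ≈ 0# → Additive p
  frobenius {zero}  p-prime = contradiction ≡.refl (ℕ.≢-nonZero⁻¹ 0 {{prime⇒nonZero p-prime}})
  frobenius {suc r} p-prime p·1≈0 x y = begin
    pow K (x + y) (suc r)             ≈⟨ pow≈^ (x + y) (suc r) ⟩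
    (x + y) ^ suc r                   ≈⟨ Frobenius.frobenius^ p-prime p·1≈0 x y ⟩
    x ^ suc r + y ^ suc r             ≈⟨ +-cong (pow≈^ x (suc r)) (pow≈^ y (suc r)) ⟨
    pow K x (suc r) + pow K y (suc r) ∎

  module Finite {m : ℕ} (card : HasCardinality K m) where
    enum : Fin m → Carrier
    enum = proj₁ card

    enum-injective : ∀ i j → enum i ≈ enum j → i ≡ j
    enum-injective = proj₁ (proj₂ card)

    index : Carrier → Fin m
    index x = proj₁ (proj₂ (proj₂ card) x)

    enum-index : ∀ x → enum (index x) ≈ x
    enum-index x = proj₂ (proj₂ (proj₂ card) x)

    index-injective : ∀ {x y} → index x ≡ index y → x ≈ y
    index-injective {x} {y} ix≡iy = begin
      x                ≈⟨ enum-index x ⟨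
      enum (index x)   ≡⟨ ≡.cong enum ix≡iy ⟩
      enum (index y)   ≈⟨ enum-index y ⟩
      y                ∎

    infix 4 _≟_
    _≟_ : ∀ x y → Dec (x ≈ y)
    x ≟ y with index x Fin.≟ index y
    ... | yes ix≡iy = yes (index-injective ix≡iy)
    ... | no  ix≢iy = no (λ x≈y → ix≢iy (enum-injective _ _
                           (trans (enum-index x) (trans x≈y (sym (enum-index y))))))

    reindexing : (Carrier → Carrier) → Fin m → Fin m
    reindexing f i = index (f (enum i))

    reindexing-injective : ∀ f → (∀ x y → f x ≈ f y → x ≈ y) →
                           ∀ i j → reindexing f i ≡ reindexing f j → i ≡ j
    reindexing-injective f f-inj i j eq = enum-injective i j (f-inj _ _ (index-injective eq))

    injective⇒surjective : (f : Carrier → Carrier) → (∀ x y → f x ≈ f y → x ≈ y) →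
                           ∀ z → Σ Carrier λ x → f x ≈ z
    injective⇒surjective f f-inj z
      with i , fi≡z ← finInjective⇒surjective _ (reindexing-injective f f-inj) (index z)
      = enum i , index-injective fi≡z

    module _ (M : CommutativeMonoid c ℓ) where
      private module M = CommutativeMonoid M
      open import Algebra.Properties.CommutativeMonoid.Sum M using (sum; sum-permute; sum-cong-≋)

      sum-reindex : (g : Carrier → M.Carrier) → (∀ {x y} → x ≈ y → g x M.≈ g y) →
                    (f : Carrier → Carrier) (f-inj : ∀ x y → f x ≈ f y → x ≈ y) →
                    sum (λ i → g (enum i)) M.≈ sum (λ i → g (f (enum i)))
      sum-reindex g g-cong f f-inj = M.trans
        (sum-permute (λ i → g (enum i)) (finInjective⇒permutation _ (reindexing-injective f f-inj)))
        (sum-cong-≋ (λ i → g-cong (enum-index (f (enum i)))))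

    -- The size of K annihilates 1: translating by 1 permutes K, so ∑ x = ∑ (x + 1) = ∑ x + m·1.
    cardinality-annihilates-1 : m × 1# ≈ 0#
    cardinality-annihilates-1 = sym (+-cancelˡ total _ _ (begin
      total + 0#                   ≈⟨ +-identityʳ total ⟩
      total                        ≈⟨ sum-reindex +-commutativeMonoid (λ x → x) (λ x≈y → x≈y)
                                        (_+ 1#) (λ x y → +-cancelʳ 1# x y) ⟩
      sum (λ i → enum i + 1#)      ≈⟨ ∑-distrib-+ enum (λ _ → 1#) ⟩
      total + sum {m} (λ _ → 1#)   ≈⟨ +-congˡ (sum-replicate m) ⟩
      total + m × 1#               ∎))
      where
      open import Algebra.Properties.CommutativeMonoid.Sum +-commutativeMonoid
        using (sum; ∑-distrib-+; sum-replicate)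
      total : Carrier
      total = sum enum

    -- If a power r^e of r annihilates 1, so does r (K has no zero divisors).
    characteristic-of-power : ∀ r e → (r ℕ.^ e) × 1# ≈ 0# → r × 1# ≈ 0#
    characteristic-of-power r e rᵉ·1≈0 with (r × 1#) ≟ 0#
    ... | yes r·1≈0 = r·1≈0
    ... | no  r·1≉0 = contradiction (trans (sym (×1-homo-^ r e)) rᵉ·1≈0) (pow-nonzero e r·1≉0)

  -- For a ≠ 0, scaling by a permutes K, so the product P of all "units" (elements with 0
  -- replaced by 1) satisfies P = a^m P; as P ≠ 0 this gives a^m = 1.
  module Fermat {m : ℕ} (card : HasCardinality K (suc m)) where
    open Finite card
    open import Algebra.Properties.CommutativeMonoid.Sum *-commutativeMonoid
      using () renaming (sum to product; sum-remove to product-remove;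
                         sum-cong-≋ to product-cong; ∑-distrib-+ to product-distrib-*;
                         sum-replicate to product-replicate)

    product-nonzero : ∀ {k} (f : Fin k → Carrier) → (∀ i → ¬ (f i ≈ 0#)) → ¬ (product f ≈ 0#)
    product-nonzero {zero}  f f≉0 = 1≉0
    product-nonzero {suc k} f f≉0 =
      nonzero-* (f≉0 Fin.zero) (product-nonzero (λ i → f (Fin.suc i)) (λ i → f≉0 (Fin.suc i)))

    unit : Carrier → Carrier
    unit x with x ≟ 0#
    ... | yes _ = 1#
    ... | no  _ = x

    unit-nonzero : ∀ x → ¬ (unit x ≈ 0#)
    unit-nonzero x with x ≟ 0#
    ... | yes _   = 1≉0
    ... | no  x≉0 = x≉0

    unit-cong : ∀ {x y} → x ≈ y → unit x ≈ unit y
    unit-cong {x} {y} x≈y with x ≟ 0# | y ≟ 0#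
    ... | yes _   | yes _   = refl
    ... | yes x≈0 | no  y≉0 = contradiction (trans (sym x≈y) x≈0) y≉0
    ... | no  x≉0 | yes y≈0 = contradiction (trans x≈y y≈0) x≉0
    ... | no  _   | no  _   = x≈y

    module _ (a : Carrier) (a≉0 : ¬ (a ≈ 0#)) where
      -- the factor by which unit x changes when x is scaled by a
      scale : Carrier → Carrier
      scale x with x ≟ 0#
      ... | yes _ = 1#
      ... | no  _ = a

      unit-scale : ∀ x → unit (a * x) ≈ scale x * unit x
      unit-scale x with a * x ≟ 0# | x ≟ 0#
      ... | yes _    | yes _   = sym (*-identityˡ 1#)
      ... | yes ax≈0 | no  x≉0 = contradiction (nonzero-cancelˡ a≉0 ax≈0) x≉0
      ... | no  ax≉0 | yes x≈0 = contradiction (trans (*-congˡ x≈0) (zeroʳ a)) ax≉0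
      ... | no  _    | no  _   = refl

      -- exactly one element (zero) has factor 1, the other m have factor a
      scale-product : product (λ i → scale (enum i)) ≈ pow K a m
      scale-product = begin
        product (λ i → scale (enum i))
          ≈⟨ product-remove {i = index 0#} (λ i → scale (enum i)) ⟩
        scale (enum (index 0#)) * product (λ j → scale (enum (punchIn (index 0#) j)))
          ≈⟨ *-cong scale-zero (product-cong scale-rest) ⟩
        1# * product {m} (λ _ → a)  ≈⟨ *-identityˡ _ ⟩
        product {m} (λ _ → a)       ≈⟨ product-replicate m ⟩
        a ^ m                       ≈⟨ pow≈^ a m ⟨
        pow K a m                   ∎
        where
        scale-zero : scale (enum (index 0#)) ≈ 1#
        scale-zero with enum (index 0#) ≟ 0#
        ... | yes _ = refl
        ... | no  e≉0 = contradiction (enum-index 0#) e≉0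
        scale-rest : ∀ j → scale (enum (punchIn (index 0#) j)) ≈ a
        scale-rest j with enum (punchIn (index 0#) j) ≟ 0#
        ... | no  _ = refl
        ... | yes e≈0 = contradiction
                          (enum-injective _ _ (trans e≈0 (sym (enum-index 0#))))
                          (FinP.punchInᵢ≢i (index 0#) j)

      units : Carrier
      units = product (λ i → unit (enum i))

      units-invariant : units ≈ pow K a m * units
      units-invariant = begin
        units
          ≈⟨ sum-reindex *-commutativeMonoid unit unit-cong (a *_) multiplication-injective ⟩
        product (λ i → unit (a * enum i))
          ≈⟨ product-cong (λ i → unit-scale (enum i)) ⟩
        product (λ i → scale (enum i) * unit (enum i))
          ≈⟨ product-distrib-* (λ i → scale (enum i)) (λ i → unit (enum i)) ⟩
        product (λ i → scale (enum i)) * units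
          ≈⟨ *-congʳ scale-product ⟩
        pow K a m * units
          ∎
        where
        multiplication-injective : ∀ x y → a * x ≈ a * y → x ≈ y
        multiplication-injective x y ax≈ay =
          x∙y⁻¹≈ε⇒x≈y x y (nonzero-cancelˡ a≉0 (trans (x[y-z]≈xy-xz a x y) (x≈y⇒x∙y⁻¹≈ε ax≈ay)))

      fermat-nonzero : pow K a m ≈ 1#
      fermat-nonzero = x∙y⁻¹≈ε⇒x≈y _ _ (nonzero-cancelʳ
        (product-nonzero _ (λ i → unit-nonzero (enum i)))
        (trans ([y-z]x≈yx-zx units (pow K a m) 1#)
               (x≈y⇒x∙y⁻¹≈ε (trans (sym units-invariant) (sym (*-identityˡ units))))))

    fermat : ∀ a → pow K a (suc m) ≈ a
    fermat a with a ≟ 0#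
    ... | yes a≈0 = trans (pow-cong (suc m) a≈0) (trans (zeroˡ _) (sym a≈0))
    ... | no  a≉0 = trans (*-congˡ (fermat-nonzero a a≉0)) (*-identityʳ a)

  -- Fermat's little theorem a^m = a for a field with m elements (m > 0 since 0 ∈ K).
  fermat : ∀ {m} → HasCardinality K m → ∀ a → pow K a m ≈ a
  fermat {zero}  (_ , _ , index) a with () ← proj₁ (index 0#)
  fermat {suc m} card            a = Fermat.fermat card a

  additive-zero : (f : Carrier → Carrier) → (∀ {x y} → x ≈ y → f x ≈ f y) →
                  (∀ x y → f (x + y) ≈ f x + f y) → f 0# ≈ 0#
  additive-zero f f-cong f-additive = +-identityʳ-unique (f 0#) (f 0#)
    (trans (sym (f-additive 0# 0#)) (f-cong (+-identityʳ 0#)))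

  additive-1 : Additive 1
  additive-1 x y = trans (*-identityʳ _) (sym (+-cong (*-identityʳ x) (*-identityʳ y)))

  additive-* : ∀ {a b} → Additive a → Additive b → Additive (a ℕ.* b)
  additive-* {a} {b} additive-a additive-b x y = begin
    pow K (x + y) (a ℕ.* b)                    ≈⟨ pow-pow (x + y) a b ⟨
    pow K (pow K (x + y) a) b                  ≈⟨ pow-cong b (additive-a x y) ⟩
    pow K (pow K x a + pow K y a) b            ≈⟨ additive-b _ _ ⟩
    pow K (pow K x a) b + pow K (pow K y a) b  ≈⟨ +-cong (pow-pow x a b) (pow-pow y a b) ⟩
    pow K x (a ℕ.* b) + pow K y (a ℕ.* b)      ∎

  additive-^ : ∀ {a} → Additive a → ∀ i → Additive (a ℕ.^ i)
  additive-^     additive-a zero    = additive-1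
  additive-^ {a} additive-a (suc i) = additive-* {a} {a ℕ.^ i} additive-a (additive-^ additive-a i)

  -- In a field of order (p^k)^n with p prime, p·1 = 0 (the order annihilates 1 and is a power
  -- of p), so by Frobenius the exponent q = p^k is additive.
  additive-of-order : ∀ {p k n} → Prime p → HasCardinality K ((p ℕ.^ k) ℕ.^ n) → Additive (p ℕ.^ k)
  additive-of-order {p} {k} {n} p-prime card =
    additive-^ {p} (frobenius p-prime p·1≈0) k
    where
    open Finite card using (cardinality-annihilates-1; characteristic-of-power)
    p·1≈0 : p × 1# ≈ 0#
    p·1≈0 = characteristic-of-power p (k ℕ.* n)
      (≡.subst (λ e → e × 1# ≈ 0#) (ℕP.^-*-assoc p k n) cardinality-annihilates-1)

  -- The fixed points of an additive power map x ↦ x^N are closed under subtraction: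
  -- (c - b)^N + b = (c - b)^N + b^N = c^N = c.
  fixed-− : ∀ {N b c} → Additive N → pow K b N ≈ b → pow K c N ≈ c → pow K (c - b) N ≈ c - b
  fixed-− {N} {b} {c} additive-N bᴺ≈b cᴺ≈c = +-cancelʳ b _ _ (begin
    pow K (c - b) N + b            ≈⟨ +-congˡ bᴺ≈b ⟨
    pow K (c - b) N + pow K b N    ≈⟨ additive-N (c - b) b ⟨
    pow K ((c - b) + b) N          ≈⟨ pow-cong N (//-rightDividesˡ b c) ⟩
    pow K c N                      ≈⟨ cᴺ≈c ⟩
    c                              ≈⟨ //-rightDividesˡ b c ⟨
    (c - b) + b                    ∎)

  module Trace {q : ℕ} (additive-q : Additive q) where

    Tr-additive : ∀ i x y → Tr K q i (x + y) ≈ Tr K q i x + Tr K q i y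
    Tr-additive zero    x y = sym (+-identityʳ 0#)
    Tr-additive (suc i) x y =
      trans (+-cong (Tr-additive i x y) (additive-^ {q} additive-q i x y)) (interchange _ _ _ _)

    Tr-zero : ∀ i → Tr K q i 0# ≈ 0#
    Tr-zero i = additive-zero (Tr K q i) (Tr-cong q i) (Tr-additive i)

    fixed-pow : ∀ {a} → pow K a q ≈ a → ∀ i → pow K a (q ℕ.^ i) ≈ a
    fixed-pow {a} aᵠ≈a zero    = *-identityʳ a
    fixed-pow {a} aᵠ≈a (suc i) = begin
      pow K a (q ℕ.* q ℕ.^ i)      ≈⟨ pow-pow a q (q ℕ.^ i) ⟨
      pow K (pow K a q) (q ℕ.^ i)  ≈⟨ pow-cong (q ℕ.^ i) aᵠ≈a ⟩
      pow K a (q ℕ.^ i)            ≈⟨ fixed-pow aᵠ≈a i ⟩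
      a                            ∎

    Tr-linear : ∀ {a} → pow K a q ≈ a → ∀ i x → Tr K q i (a * x) ≈ a * Tr K q i x
    Tr-linear {a} aᵠ≈a zero    x = sym (zeroʳ a)
    Tr-linear {a} aᵠ≈a (suc i) x = begin
      Tr K q i (a * x) + pow K (a * x) (q ℕ.^ i)             ≈⟨ +-cong (Tr-linear aᵠ≈a i x)
                                                                       (pow-distrib-* a x (q ℕ.^ i)) ⟩
      a * Tr K q i x + pow K a (q ℕ.^ i) * pow K x (q ℕ.^ i) ≈⟨ +-congˡ (*-congʳ (fixed-pow aᵠ≈a i)) ⟩
      a * Tr K q i x + a * pow K x (q ℕ.^ i)                 ≈⟨ distribˡ a _ _ ⟨
      a * (Tr K q i x + pow K x (q ℕ.^ i))                   ∎

    Tr-telescope : ∀ i y → pow K (Tr K q i y) q + y ≈ Tr K q i y + pow K y (q ℕ.^ i)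
    Tr-telescope zero y = +-cong (additive-zero (λ x → pow K x q) (pow-cong q) additive-q)
                                 (sym (*-identityʳ y))
    Tr-telescope (suc i) y = begin
      pow K (Tr K q i y + yⁱ) q + y            ≈⟨ +-congʳ (additive-q _ _) ⟩
      (pow K (Tr K q i y) q + pow K yⁱ q) + y  ≈⟨ +-assoc _ _ _ ⟩
      pow K (Tr K q i y) q + (pow K yⁱ q + y)  ≈⟨ +-congˡ (+-comm _ _) ⟩
      pow K (Tr K q i y) q + (y + pow K yⁱ q)  ≈⟨ +-assoc _ _ _ ⟨
      (pow K (Tr K q i y) q + y) + pow K yⁱ q  ≈⟨ +-cong (Tr-telescope i y) yⁱ⁺¹ ⟩
      (Tr K q i y + yⁱ) + pow K y (q ℕ.^ suc i) ∎
      where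
      yⁱ : Carrier
      yⁱ = pow K y (q ℕ.^ i)
      yⁱ⁺¹ : pow K yⁱ q ≈ pow K y (q ℕ.^ suc i)
      yⁱ⁺¹ = trans (pow-pow y (q ℕ.^ i) q) (reflexive (≡.cong (pow K y) (ℕP.*-comm (q ℕ.^ i) q)))

    Tr-fixed : ∀ n → (∀ y → pow K y (q ℕ.^ n) ≈ y) → ∀ y → pow K (Tr K q n y) q ≈ Tr K q n y
    Tr-fixed n fermat-qⁿ y = +-cancelʳ y _ _ (trans (Tr-telescope n y) (+-congˡ (fermat-qⁿ y)))

  module Criterion {q n : ℕ} (additive-q : Additive q) (1≤q : 1 ≤ q)
                   (trace-fixed : ∀ y → pow K (Tr K q n y) q ≈ Tr K q n y)
                   (H : List Carrier) (γ β : Carrier) where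
    open Trace {q} additive-q using (Tr-additive; Tr-zero; Tr-linear)

    L : Carrier → Carrier
    L x = pow K x q - pow K γ (q ∸ 1) * x

    G : Carrier → Carrier
    G x = Tr K q n (eval K H (L x) + β * x)

    F : Carrier → Carrier
    F x = x + γ * G x

    t : Carrier
    t = Tr K q n (γ * β)

    F-cong : ∀ {x y} → x ≈ y → F x ≈ F y
    F-cong x≈y = +-cong x≈y (*-congˡ (Tr-cong q n (+-cong
      (eval-cong H (+-cong (pow-cong q x≈y) (-‿cong (*-congˡ x≈y)))) (*-congˡ x≈y))))

    module Shift {a : Carrier} (aᵠ≈a : pow K a q ≈ a) where
      -- γ a lies in the kernel of L: (γ a)^q = γ^q a = γ^(q-1) (γ a)
      shift-in-kernel : pow K (γ * a) q ≈ pow K γ (q ∸ 1) * (γ * a)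
      shift-in-kernel = begin
        pow K (γ * a) q                       ≈⟨ pow-distrib-* γ a q ⟩
        pow K γ q * pow K a q                 ≈⟨ *-cong (pow-pred γ 1≤q) aᵠ≈a ⟩
        (γ * pow K γ (q ∸ 1)) * a             ≈⟨ *-congʳ (*-comm γ _) ⟩
        (pow K γ (q ∸ 1) * γ) * a             ≈⟨ *-assoc _ γ a ⟩
        pow K γ (q ∸ 1) * (γ * a)             ∎

      L-shift : ∀ x → L (x + γ * a) ≈ L x
      L-shift x = begin
        pow K (x + γ * a) q - cᵧ * (x + γ * a)
          ≈⟨ +-cong (additive-q x (γ * a)) (-‿cong (distribˡ cᵧ x (γ * a))) ⟩
        (pow K x q + pow K (γ * a) q) - (cᵧ * x + cᵧ * (γ * a))
          ≈⟨ +-congʳ (+-congˡ shift-in-kernel) ⟩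
        (pow K x q + cᵧ * (γ * a)) - (cᵧ * x + cᵧ * (γ * a))
          ≈⟨ +-congˡ (sym (-‿+-comm (cᵧ * x) _)) ⟩
        (pow K x q + cᵧ * (γ * a)) + (- (cᵧ * x) + - (cᵧ * (γ * a)))
          ≈⟨ interchange _ _ _ _ ⟩
        L x + (cᵧ * (γ * a) - cᵧ * (γ * a))
          ≈⟨ +-congˡ (-‿inverseʳ _) ⟩
        L x + 0#
          ≈⟨ +-identityʳ (L x) ⟩
        L x
          ∎
        where
        cᵧ : Carrier
        cᵧ = pow K γ (q ∸ 1)

      G-shift : ∀ x → G (x + γ * a) ≈ G x + a * t
      G-shift x = begin
        Tr K q n (eval K H (L (x + γ * a)) + β * (x + γ * a))
                      ≈⟨ Tr-cong q n (+-cong (eval-cong H (L-shift x)) (distribˡ β x (γ * a))) ⟩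
        Tr K q n (eval K H (L x) + (β * x + β * (γ * a)))
                      ≈⟨ Tr-cong q n (sym (+-assoc _ _ _)) ⟩
        Tr K q n ((eval K H (L x) + β * x) + β * (γ * a))
                      ≈⟨ Tr-additive n _ _ ⟩
        G x + Tr K q n (β * (γ * a))
                      ≈⟨ +-congˡ (Tr-cong q n βγa≈aγβ) ⟩
        G x + Tr K q n (a * (γ * β))
                      ≈⟨ +-congˡ (Tr-linear aᵠ≈a n (γ * β)) ⟩
        G x + a * t   ∎
        where
        βγa≈aγβ : β * (γ * a) ≈ a * (γ * β)
        βγa≈aγβ = trans (*-comm β _) (trans (*-congʳ (*-comm γ a)) (*-assoc a γ β))

      F-shift : ∀ x → F (x + γ * a) ≈ F x + (γ * a) * (1# + t)
      F-shift x = begin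
        (x + γ * a) + γ * G (x + γ * a)       ≈⟨ +-congˡ (*-congˡ (G-shift x)) ⟩
        (x + γ * a) + γ * (G x + a * t)       ≈⟨ +-congˡ (distribˡ γ _ _) ⟩
        (x + γ * a) + (γ * G x + γ * (a * t)) ≈⟨ interchange _ _ _ _ ⟩
        F x + (γ * a + γ * (a * t))           ≈⟨ +-congˡ (+-cong (*-identityʳ _) (*-assoc γ a t)) ⟨
        F x + ((γ * a) * 1# + (γ * a) * t)    ≈⟨ +-congˡ (distribˡ (γ * a) 1# t) ⟨
        F x + (γ * a) * (1# + t)              ∎

    open Shift

    -- If Tr(γβ) = -1, shifting by γ does not change F, so injectivity forces γ = 0 and
    -- then Tr(γβ) = 0 ≠ -1.
    permutation⇒trace≉-1 : IsPermutation K F → ¬ (t ≈ - 1#)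
    permutation⇒trace≉-1 (F-injective , _) t≈-1 = 1≉0 (begin
      1#       ≈⟨ +-identityʳ 1# ⟨
      1# + 0#  ≈⟨ +-congˡ t≈0 ⟨
      1# + t   ≈⟨ 1+t≈0 ⟩
      0#       ∎)
      where
      1+t≈0 : 1# + t ≈ 0#
      1+t≈0 = trans (+-congˡ t≈-1) (-‿inverseʳ 1#)
      γ-invisible : F (0# + γ * 1#) ≈ F 0#
      γ-invisible = begin
        F (0# + γ * 1#)                ≈⟨ F-shift (pow-1# q) 0# ⟩
        F 0# + (γ * 1#) * (1# + t)     ≈⟨ +-congˡ (*-congˡ 1+t≈0) ⟩
        F 0# + (γ * 1#) * 0#           ≈⟨ +-congˡ (zeroʳ _) ⟩
        F 0# + 0#                      ≈⟨ +-identityʳ _ ⟩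
        F 0#                           ∎
      γ≈0 : γ ≈ 0#
      γ≈0 = trans (sym (*-identityʳ γ))
                  (+-identityʳ-unique 0# _ (F-injective _ _ γ-invisible))
      t≈0 : t ≈ 0#
      t≈0 = trans (Tr-cong q n (trans (*-congʳ γ≈0) (zeroˡ β))) (Tr-zero n)

    -- If Tr(γβ) ≠ -1, a collision F(x) = F(y) gives x = y + γ a with a = G(y) - G(x) ∈ 𝔽,
    -- so 0 = (γ a)(1 + t) and hence γ a = 0, x = y.
    trace≉-1⇒injective : ¬ (t ≈ - 1#) → ∀ x y → F x ≈ F y → x ≈ y
    trace≉-1⇒injective t≉-1 x y Fx≈Fy = begin
      x            ≈⟨ x≈y+γa ⟩
      y + γ * a    ≈⟨ +-congˡ γa≈0 ⟩
      y + 0#       ≈⟨ +-identityʳ y ⟩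
      y            ∎
      where
      a : Carrier
      a = G y - G x
      x≈y+γa : x ≈ y + γ * a
      x≈y+γa = begin
        x                           ≈⟨ //-rightDividesʳ (γ * G x) x ⟨
        F x - γ * G x               ≈⟨ +-congʳ Fx≈Fy ⟩
        (y + γ * G y) - γ * G x     ≈⟨ +-assoc _ _ _ ⟩
        y + (γ * G y - γ * G x)     ≈⟨ +-congˡ (x[y-z]≈xy-xz γ (G y) (G x)) ⟨
        y + γ * a                   ∎
      aᵠ≈a : pow K a q ≈ a
      aᵠ≈a = fixed-− {q} additive-q (trace-fixed _) (trace-fixed _)
      collapse : (γ * a) * (1# + t) ≈ 0#
      collapse = +-identityʳ-unique (F y) _ (begin
        F y + (γ * a) * (1# + t)    ≈⟨ F-shift aᵠ≈a y ⟨
        F (y + γ * a)               ≈⟨ F-cong x≈y+γa ⟨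
        F x                         ≈⟨ Fx≈Fy ⟩
        F y                         ∎)
      γa≈0 : γ * a ≈ 0#
      γa≈0 = nonzero-cancelʳ (λ 1+t≈0 → t≉-1 (+-inverseʳ-unique 1# t 1+t≈0)) collapse

    trace≉-1⇒permutation : ∀ {m} → HasCardinality K m → ¬ (t ≈ - 1#) → IsPermutation K F
    trace≉-1⇒permutation card t≉-1 =
      F-injective , Finite.injective⇒surjective card F F-injective
      where
      F-injective : ∀ x y → F x ≈ F y → x ≈ y
      F-injective = trace≉-1⇒injective t≉-1

-- Theorem 9: F is a permutation of K iff Tr(γβ) ≠ -1.
mainTheorem9 : {c ℓ : Level} (q n : ℕ) → IsPrimePower q → 1 ≤ n →
    (K : Field c ℓ) → HasCardinality K (q ℕ.^ n) →
    (H : List (Field.Carrier K)) (γ β : Field.Carrier K) →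
    let open Field K in
    IsPermutation K (λ x → x + γ * Tr K q n (eval K H (pow K x q - pow K γ (q ∸ 1) * x) + β * x))
    ⇔ (¬ (Tr K q n (γ * β) ≈ - 1#))
mainTheorem9 q n (p , k , p-prime , _ , ≡.refl) _ K card H γ β =
  mk⇔ permutation⇒trace≉-1 (trace≉-1⇒permutation card)
  where
  open Field K using (_≈_)
  open FieldTheory K
  -- q = p^k is additive since K has characteristic p,
  additive-q : Additive (p ℕ.^ k)
  additive-q = additive-of-order {p} {k} {n} p-prime card
  1≤q : 1 ≤ p ℕ.^ k
  1≤q = ℕP.m^n>0 p {{prime⇒nonZero p-prime}} k
  -- and by Fermat (y^(q^n) = y) the trace lands in the fixed field of x ↦ x^q.
  trace-fixed : ∀ y → pow K (Tr K (p ℕ.^ k) n y) (p ℕ.^ k) ≈ Tr K (p ℕ.^ k) n y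
  trace-fixed = Trace.Tr-fixed {p ℕ.^ k} additive-q n (fermat card)
  open Criterion {p ℕ.^ k} {n} additive-q 1≤q trace-fixed H γ β
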